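{- (a) For all $p=2^n\ge 8$, all $k\in\{1,\dots,p/2\}$, and all $i\in\{1,\dots,p\}$ distinct from $k$ and $k+p/2$: $\sigma_{p,k}(i)=\sigma_{p,k+p/2}(i)$. (b) For all $p=2^n\ge 8$, all $i\in\{1,\dots,p/2\}$, and all $k\in\{1,\dots,p\}$ distinct from $i$ and $i+p/2$: $\sigma_{p,k}(i+p/2)=\sigma_{p,k}(i)-p/2$. (c) For all $p=2^n\ge 8$ and all distinct $i,j\in\{1,\dots,p\}$: $j=i+p/2$ if and only if $\sigma_{p,i}(j)=i+p/2$, and $j=i-p/2$ if and only if $\sigma_{p,i}(j)=i-p/2$. (d) For all $p=2^n\ge 8$, all $k\in\{1,\dots,p\}$, and all $i,j\in\{1,\dots,p\}$ distinct from $k$: $j=i+p/2$ if and only if $\sigma_{p,k}(i)=\sigma_{p,k}(j)+p/2$, and $j=i-p/2$ if and only if $\sigma_{p,k}(i)=\sigma_{p,k}(j)-p/2$.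
   Context: Throughout, $p=2^n$ with $n\ge 2$. For each $k\in\{1,\dots,p\}$, $\sigma_{p,k}$ is a map from $\{1,\dots,p\}\setminus\{k\}$ to itself, defined inductively. For $p=4$: $\sigma_{4,1}: 2\mapsto 4, 3\mapsto 2, 4\mapsto 3$; $\sigma_{4,2}: 1\mapsto 3, 3\mapsto 4, 4\mapsto 1$; $\sigma_{4,3}: 1\mapsto 4, 2\mapsto 1, 4\mapsto 2$; $\sigma_{4,4}: 1\mapsto 2, 2\mapsto 3, 3\mapsto 1$. For $p\ge 8$ and $i\ne k$: if $k\le p/2$, then $\sigma_{p,k}(i)=\sigma_{p/2,k}(i)+p/2$ for $i\le p/2$; $\sigma_{p,k}(i)=\sigma_{p/2,k}(i-p/2)$ for $i>p/2$, $i\ne k+p/2$; and $\sigma_{p,k}(k+p/2)=k+p/2$. If $k>p/2$, then $\sigma_{p,k}(i)=\sigma_{p/2,k-p/2}(i)+p/2$ for $i\le p/2$, $i\ne k-p/2$; $\sigma_{p,k}(i)=\sigma_{p/2,k-p/2}(i-p/2)$ for $i>p/2$; and $\sigma_{p,k}(k-p/2)=k-p/2$. -}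

module Defs where

open import Data.Nat using (ℕ; zero; suc; _+_; _∸_; _^_; _≤ᵇ_; _≡ᵇ_)
open import Data.Bool using (if_then_else_)

-- σ₄ k i : the map σ_{4,k} applied to i (values for i = k or out of range are
-- junk 0 and never used).
σ₄ : ℕ → ℕ → ℕ
σ₄ 1 2 = 4
σ₄ 1 3 = 2
σ₄ 1 4 = 3
σ₄ 2 1 = 3
σ₄ 2 3 = 4
σ₄ 2 4 = 1
σ₄ 3 1 = 4
σ₄ 3 2 = 1
σ₄ 3 4 = 2
σ₄ 4 1 = 2
σ₄ 4 2 = 3
σ₄ 4 3 = 1
σ₄ _ _ = 0

-- σ m k i : the map σ_{p,k} with p = 2 ^ m, applied to i (meaningful for m ≥ 2,
-- 1 ≤ k, i ≤ p, i ≠ k; other values are junk).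
σ : ℕ → ℕ → ℕ → ℕ
σ zero _ _ = 0
σ (suc zero) _ _ = 0
σ (suc (suc zero)) k i = σ₄ k i
σ (suc (suc (suc m))) k i =
  let h = 2 ^ (suc (suc m)) in
  if k ≤ᵇ h
  then (if i ≤ᵇ h
        then σ (suc (suc m)) k i + h
        else (if i ≡ᵇ (k + h) then k + h else σ (suc (suc m)) k (i ∸ h)))
  else (if i ≤ᵇ h
        then (if i ≡ᵇ (k ∸ h) then k ∸ h else σ (suc (suc m)) (k ∸ h) i + h)
        else σ (suc (suc m)) (k ∸ h) (i ∸ h))

{-# OPTIONS --safe #-}
-- Write p = H + H and let κ be k reduced into {1, …, H}. Unfolding the recursion,
-- σ_{p,k} fixes the partner of k (k + H or k − H) and maps every other x ≤ H to
-- σ_{H,κ}(x) + H and x + H to σ_{H,κ}(x); parts (a) and (b) are read off from this.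
-- Parts (c) and (d) also need that σ_{p,k} is an injective map of {1, …, p} ∖ {k} into
-- itself. Both properties pass from σ_{H,κ} to σ_{p,k}; for p = 4 every σ_{4,k} is a
-- 3-cycle, so σ_{4,k} ∘ σ_{4,k} is a left inverse, and left inverses also pass up the
-- recursion.
module Submission where

open import Defs
open import Data.Nat using (ℕ; zero; suc; _+_; _∸_; _^_; _≤_; _<_; _≤ᵇ_; _≡ᵇ_; s≤s; _≤?_; _≟_)
open import Data.Nat.Properties
open import Data.Bool using (true; false; if_then_else_)
open import Data.Product using (_×_; _,_; proj₁; proj₂; Σ)
open import Data.Empty using (⊥-elim)
open import Function.Base using (_∘_)
open import Function.Bundles using (_⇔_; mk⇔; Equivalence)
open import Relation.Binary.PropositionalEquality
open import Relation.Nullary using (yes; no)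
open import Relation.Nullary.Decidable using (dec-true; dec-false; True; toWitness; _×-dec_; ¬?)

InRange : ℕ → ℕ → Set
InRange N x = 1 ≤ x × x ≤ N

Domain : ℕ → ℕ → ℕ → Set
Domain N k i = InRange N i × i ≢ k

MapsInto : ℕ → (ℕ → ℕ → ℕ) → Set
MapsInto N f = ∀ {k i} → InRange N k → Domain N k i → Domain N k (f k i)

Injective : ℕ → (ℕ → ℕ → ℕ) → Set
Injective N f = ∀ {k i j} → InRange N k → Domain N k i → Domain N k j → f k i ≡ f k j → i ≡ j

LeftInverse : ℕ → (ℕ → ℕ → ℕ) → (ℕ → ℕ → ℕ) → Set
LeftInverse N g f = ∀ {k i} → InRange N k → Domain N k i → g k (f k i) ≡ i

left-inverse⇒injective : ∀ {N f g} → LeftInverse N g f → Injective N f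
left-inverse⇒injective {g = g} inv {k} k∈ i∈ j∈ eq =
  trans (sym (inv k∈ i∈)) (trans (cong (g k) eq) (inv k∈ j∈))

-- The recursive step of σ: σ (3 + n) is definitionally double (2 ^ (2 + n)) (σ (2 + n)).
double : ℕ → (ℕ → ℕ → ℕ) → ℕ → ℕ → ℕ
double h f k i =
  if k ≤ᵇ h
  then (if i ≤ᵇ h
        then f k i + h
        else (if i ≡ᵇ (k + h) then k + h else f k (i ∸ h)))
  else (if i ≤ᵇ h
        then (if i ≡ᵇ (k ∸ h) then k ∸ h else f (k ∸ h) i + h)
        else f (k ∸ h) (i ∸ h))

≤ᵇ-true : ∀ {m n} → m ≤ n → (m ≤ᵇ n) ≡ true
≤ᵇ-true = dec-true (_ ≤? _)

≤ᵇ-false : ∀ {m n} → n < m → (m ≤ᵇ n) ≡ false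
≤ᵇ-false n<m = dec-false (_ ≤? _) (<⇒≱ n<m)

≡ᵇ-refl : ∀ m → (m ≡ᵇ m) ≡ true
≡ᵇ-refl m = dec-true (m ≟ m) refl

≡ᵇ-false : ∀ {m n} → m ≢ n → (m ≡ᵇ n) ≡ false
≡ᵇ-false = dec-false (_ ≟ _)

module Halves {H : ℕ} where

  upper∈ : ∀ {x} → InRange H x → InRange (H + H) (x + H)
  upper∈ (1≤x , x≤H) = ≤-trans 1≤x (m≤m+n _ H) , +-monoˡ-≤ H x≤H

  lower∈ : ∀ {x} → InRange H x → InRange (H + H) x
  lower∈ (1≤x , x≤H) = 1≤x , ≤-trans x≤H (m≤m+n H H)

  H<x+H : ∀ {x} → 1 ≤ x → H < x + H
  H<x+H 1≤x = m<n+m _ 1≤x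

  upper≢lower : ∀ {x y} → 1 ≤ x → y ≤ H → x + H ≢ y
  upper≢lower 1≤x y≤H refl = <⇒≱ (H<x+H 1≤x) y≤H

  +H-injective : ∀ {x y} → x + H ≡ y + H → x ≡ y
  +H-injective = +-cancelʳ-≡ H _ _

  x+H≤H+H⇒x≤H : ∀ {x} → x + H ≤ H + H → x ≤ H
  x+H≤H+H⇒x≤H = +-cancelʳ-≤ H _ H

  data Half : ℕ → Set where
    lower : ∀ {x} → InRange H x → Half x
    upper : ∀ {x} → InRange H x → Half (x + H)

  half : ∀ {i} → InRange (H + H) i → Half i
  half {i} (1≤i , i≤2H) with i ≤? H
  ... | yes i≤H = lower (1≤i , i≤H)
  ... | no i≰H = subst Half (m∸n+n≡m (<⇒≤ H<i)) (upper (m+n≤o⇒m≤o∸n 1 H<i , m≤n+o⇒m∸n≤o i H i≤2H))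
    where H<i = ≰⇒> i≰H

  data Config : ℕ → ℕ → Set where
    partner↑ : ∀ {κ} → InRange H κ → Config κ (κ + H)
    partner↓ : ∀ {κ} → InRange H κ → Config (κ + H) κ
    lo-lo : ∀ {κ x} → InRange H κ → InRange H x → x ≢ κ → Config κ x
    lo-hi : ∀ {κ x} → InRange H κ → InRange H x → x ≢ κ → Config κ (x + H)
    hi-lo : ∀ {κ x} → InRange H κ → InRange H x → x ≢ κ → Config (κ + H) x
    hi-hi : ∀ {κ x} → InRange H κ → InRange H x → x ≢ κ → Config (κ + H) (x + H)

  config : ∀ {k i} → InRange (H + H) k → Domain (H + H) k i → Config k i
  config k∈ (i∈ , i≢k) with half k∈ | half i∈
  ... | lower κ∈ | lower x∈ = lo-lo κ∈ x∈ i≢k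
  ... | upper κ∈ | upper x∈ = hi-hi κ∈ x∈ (i≢k ∘ cong (_+ H))
  ... | lower {κ} κ∈ | upper {x} x∈ with x ≟ κ
  ...   | yes refl = partner↑ κ∈
  ...   | no x≢κ = lo-hi κ∈ x∈ x≢κ
  config k∈ (i∈ , i≢k) | upper {κ} κ∈ | lower {x} x∈ with x ≟ κ
  ...   | yes refl = partner↓ κ∈
  ...   | no x≢κ = hi-lo κ∈ x∈ x≢κ

module Doubling {H : ℕ} (f : ℕ → ℕ → ℕ) where
  open Halves {H}

  double-partner↑ : ∀ {κ} → InRange H κ → double H f κ (κ + H) ≡ κ + H
  double-partner↑ {κ} (1≤κ , κ≤H)
    rewrite ≤ᵇ-true κ≤H | ≤ᵇ-false (H<x+H 1≤κ) | ≡ᵇ-refl (κ + H) = refl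

  double-partner↓ : ∀ {κ} → InRange H κ → double H f (κ + H) κ ≡ κ
  double-partner↓ {κ} (1≤κ , κ≤H)
    rewrite ≤ᵇ-false (H<x+H 1≤κ) | ≤ᵇ-true κ≤H | m+n∸n≡m κ H | ≡ᵇ-refl κ = refl

  double-lo-lo : ∀ {κ x} → InRange H κ → InRange H x → double H f κ x ≡ f κ x + H
  double-lo-lo (_ , κ≤H) (_ , x≤H) rewrite ≤ᵇ-true κ≤H | ≤ᵇ-true x≤H = refl

  double-lo-hi : ∀ {κ x} → InRange H κ → InRange H x → x ≢ κ → double H f κ (x + H) ≡ f κ x
  double-lo-hi {κ} {x} (_ , κ≤H) (1≤x , _) x≢κ
    rewrite ≤ᵇ-true κ≤H | ≤ᵇ-false (H<x+H 1≤x) | ≡ᵇ-false (x≢κ ∘ +H-injective)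
          | m+n∸n≡m x H = refl

  double-hi-lo : ∀ {κ x} → InRange H κ → InRange H x → x ≢ κ → double H f (κ + H) x ≡ f κ x + H
  double-hi-lo {κ} {x} (1≤κ , _) (_ , x≤H) x≢κ
    rewrite ≤ᵇ-false (H<x+H 1≤κ) | ≤ᵇ-true x≤H | m+n∸n≡m κ H | ≡ᵇ-false x≢κ = refl

  double-hi-hi : ∀ {κ x} → InRange H κ → InRange H x → double H f (κ + H) (x + H) ≡ f κ x
  double-hi-hi {κ} {x} (1≤κ , _) (1≤x , _)
    rewrite ≤ᵇ-false (H<x+H 1≤κ) | ≤ᵇ-false (H<x+H 1≤x) | m+n∸n≡m κ H | m+n∸n≡m x H = refl

  double-maps-into : MapsInto H f → MapsInto (H + H) (double H f)
  double-maps-into f-maps k∈ i∈ with config k∈ i∈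
  ... | partner↑ κ∈ rewrite double-partner↑ κ∈ = upper∈ κ∈ , upper≢lower (proj₁ κ∈) (proj₂ κ∈)
  ... | partner↓ κ∈ rewrite double-partner↓ κ∈ = lower∈ κ∈ , upper≢lower (proj₁ κ∈) (proj₂ κ∈) ∘ sym
  ... | lo-lo κ∈ x∈ x≢κ rewrite double-lo-lo κ∈ x∈ =
    let (v∈ , _) = f-maps κ∈ (x∈ , x≢κ) in upper∈ v∈ , upper≢lower (proj₁ v∈) (proj₂ κ∈)
  ... | lo-hi κ∈ x∈ x≢κ rewrite double-lo-hi κ∈ x∈ x≢κ =
    let (v∈ , v≢κ) = f-maps κ∈ (x∈ , x≢κ) in lower∈ v∈ , v≢κ
  ... | hi-lo κ∈ x∈ x≢κ rewrite double-hi-lo κ∈ x∈ x≢κ =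
    let (v∈ , v≢κ) = f-maps κ∈ (x∈ , x≢κ) in upper∈ v∈ , v≢κ ∘ +H-injective
  ... | hi-hi κ∈ x∈ x≢κ rewrite double-hi-hi κ∈ x∈ =
    let (v∈ , _) = f-maps κ∈ (x∈ , x≢κ) in lower∈ v∈ , upper≢lower (proj₁ κ∈) (proj₂ v∈) ∘ sym

  double[κ]≡double[κ+H] : ∀ {κ i} → InRange H κ → InRange (H + H) i → i ≢ κ → i ≢ κ + H →
    double H f κ i ≡ double H f (κ + H) i
  double[κ]≡double[κ+H] κ∈ i∈ i≢κ i≢κ+H with half i∈
  ... | lower x∈ = trans (double-lo-lo κ∈ x∈) (sym (double-hi-lo κ∈ x∈ i≢κ))
  ... | upper x∈ = trans (double-lo-hi κ∈ x∈ x≢κ) (sym (double-hi-hi κ∈ x∈))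
    where x≢κ = i≢κ+H ∘ cong (_+ H)

  double[x+H]+H≡double[x] : ∀ {x k} → InRange H x → InRange (H + H) k → k ≢ x → k ≢ x + H →
    double H f k (x + H) + H ≡ double H f k x
  double[x+H]+H≡double[x] x∈ k∈ k≢x k≢x+H with half k∈
  ... | lower κ∈ = trans (cong (_+ H) (double-lo-hi κ∈ x∈ (k≢x ∘ sym))) (sym (double-lo-lo κ∈ x∈))
  ... | upper κ∈ = trans (cong (_+ H) (double-hi-hi κ∈ x∈)) (sym (double-hi-lo κ∈ x∈ x≢κ))
    where x≢κ = k≢x+H ∘ sym ∘ cong (_+ H)

  module _ (f-maps : MapsInto H f) (double-injective : Injective (H + H) (double H f)) where

    private
      v≢w+H+H : ∀ {v w} → 1 ≤ w → v ≤ H + H → v ≢ w + H + H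
      v≢w+H+H {w = w} 1≤w v≤ refl =
        n≮n (H + H) (≤-trans (+-monoˡ-≤ H (+-monoˡ-≤ H 1≤w)) v≤)

    j≡i+H⇔double≡i+H : ∀ {i j} → InRange (H + H) i → Domain (H + H) i j →
      (j ≡ i + H) ⇔ (double H f i j ≡ i + H)
    j≡i+H⇔double≡i+H {i} {j} i∈ j∈ = mk⇔ to from
      where
      to : j ≡ i + H → double H f i j ≡ i + H
      to refl = double-partner↑ (proj₁ i∈ , x+H≤H+H⇒x≤H (proj₂ (proj₁ j∈)))
      from : double H f i j ≡ i + H → j ≡ i + H
      from e = double-injective i∈ j∈ (upper∈ κ∈ , upper≢lower (proj₁ κ∈) (proj₂ κ∈))
                 (trans e (sym (double-partner↑ κ∈)))
        where
        κ∈ : InRange H i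
        κ∈ = proj₁ i∈ , x+H≤H+H⇒x≤H (subst (_≤ H + H) e (proj₂ (proj₁ (double-maps-into f-maps i∈ j∈))))

    j+H≡i⇔double+H≡i : ∀ {i j} → InRange (H + H) i → Domain (H + H) i j →
      (j + H ≡ i) ⇔ (double H f i j + H ≡ i)
    j+H≡i⇔double+H≡i {i} {j} i∈ j∈ = mk⇔ to from
      where
      to : j + H ≡ i → double H f i j + H ≡ i
      to refl = cong (_+ H) (double-partner↓ (proj₁ (proj₁ j∈) , x+H≤H+H⇒x≤H (proj₂ i∈)))
      from : double H f i j + H ≡ i → j + H ≡ i
      from e = trans (cong (_+ H) j≡v) e
        where
        v = double H f i j
        v∈ = double-maps-into f-maps i∈ j∈
        v∈H : InRange H v
        v∈H = proj₁ (proj₁ v∈) , x+H≤H+H⇒x≤H (subst (_≤ H + H) (sym e) (proj₂ i∈))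
        j≡v : j ≡ v
        j≡v = double-injective i∈ j∈ v∈ (sym (subst (λ k → double H f k v ≡ v) e (double-partner↓ v∈H)))

    j≡i+H⇔double[i]≡double[j]+H : ∀ {k i j} → InRange (H + H) k → Domain (H + H) k i → Domain (H + H) k j →
      (j ≡ i + H) ⇔ (double H f k i ≡ double H f k j + H)
    j≡i+H⇔double[i]≡double[j]+H {k} {i} {j} k∈ i∈ j∈ = mk⇔ to (from (half (proj₁ j∈)) j∈)
      where
      to : j ≡ i + H → double H f k i ≡ double H f k j + H
      to refl = sym (double[x+H]+H≡double[x] (proj₁ (proj₁ i∈) , x+H≤H+H⇒x≤H (proj₂ (proj₁ j∈)))
                       k∈ (proj₂ i∈ ∘ sym) (proj₂ j∈ ∘ sym))
      Ti∈ = double-maps-into f-maps k∈ i∈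
      -- j cannot be lower: the image of i would then be k or exceed H + H.
      from : ∀ {j} → Half j → Domain (H + H) k j → double H f k i ≡ double H f k j + H → j ≡ i + H
      from (lower {y} y∈) (_ , y≢k) e with y + H ≟ k
      ... | yes refl = ⊥-elim (proj₂ Ti∈ (trans e (cong (_+ H) (double-partner↓ y∈))))
      ... | no y+H≢k = ⊥-elim (v≢w+H+H (proj₁ (proj₁ Ty+H∈)) (proj₂ (proj₁ Ti∈))
              (trans e (cong (_+ H) (sym (double[x+H]+H≡double[x] y∈ k∈ (y≢k ∘ sym) (y+H≢k ∘ sym))))))
        where Ty+H∈ = double-maps-into f-maps k∈ (upper∈ y∈ , y+H≢k)
      from (upper {y} y∈) (_ , y+H≢k) e with y ≟ k
      ... | yes refl = ⊥-elim (v≢w+H+H (proj₁ y∈) (proj₂ (proj₁ Ti∈))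
              (trans e (cong (_+ H) (double-partner↑ y∈))))
      ... | no y≢k = cong (_+ H) (sym (double-injective k∈ i∈ (lower∈ y∈ , y≢k)
              (trans e (double[x+H]+H≡double[x] y∈ k∈ (y≢k ∘ sym) (y+H≢k ∘ sym)))))

    j+H≡i⇔double[i]+H≡double[j] : ∀ {k i j} → InRange (H + H) k → Domain (H + H) k i → Domain (H + H) k j →
      (j + H ≡ i) ⇔ (double H f k i + H ≡ double H f k j)
    j+H≡i⇔double[i]+H≡double[j] k∈ i∈ j∈ = mk⇔ (sym ∘ to ∘ sym) (sym ∘ from ∘ sym)
      where open Equivalence (j≡i+H⇔double[i]≡double[j]+H k∈ j∈ i∈)

module _ {H : ℕ} {f g : ℕ → ℕ → ℕ} where
  open Halves {H}
  private
    module F = Doubling {H} f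
    module G = Doubling {H} g

    via : ∀ k {i y} → double H f k i ≡ y → double H g k y ≡ i → double H g k (double H f k i) ≡ i
    via k f-eq g-eq = trans (cong (double H g k) f-eq) g-eq

  double-left-inverse : MapsInto H f → LeftInverse H g f → LeftInverse (H + H) (double H g) (double H f)
  double-left-inverse f-maps inv {k} k∈ i∈ with config k∈ i∈
  ... | partner↑ κ∈ = via k (F.double-partner↑ κ∈) (G.double-partner↑ κ∈)
  ... | partner↓ κ∈ = via k (F.double-partner↓ κ∈) (G.double-partner↓ κ∈)
  ... | lo-lo κ∈ x∈ x≢κ = let (v∈ , v≢κ) = f-maps κ∈ (x∈ , x≢κ) in
    via k (F.double-lo-lo κ∈ x∈) (trans (G.double-lo-hi κ∈ v∈ v≢κ) (inv κ∈ (x∈ , x≢κ)))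
  ... | lo-hi κ∈ x∈ x≢κ = let (v∈ , _) = f-maps κ∈ (x∈ , x≢κ) in
    via k (F.double-lo-hi κ∈ x∈ x≢κ) (trans (G.double-lo-lo κ∈ v∈) (cong (_+ H) (inv κ∈ (x∈ , x≢κ))))
  ... | hi-lo κ∈ x∈ x≢κ = let (v∈ , _) = f-maps κ∈ (x∈ , x≢κ) in
    via k (F.double-hi-lo κ∈ x∈ x≢κ) (trans (G.double-hi-hi κ∈ v∈) (inv κ∈ (x∈ , x≢κ)))
  ... | hi-hi κ∈ x∈ x≢κ = let (v∈ , v≢κ) = f-maps κ∈ (x∈ , x≢κ) in
    via k (F.double-hi-hi κ∈ x∈) (trans (G.double-hi-lo κ∈ v∈ v≢κ) (cong (_+ H) (inv κ∈ (x∈ , x≢κ))))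

σ₄-domain-elim : (P : ℕ → ℕ → Set) →
  P 1 2 → P 1 3 → P 1 4 → P 2 1 → P 2 3 → P 2 4 →
  P 3 1 → P 3 2 → P 3 4 → P 4 1 → P 4 2 → P 4 3 →
  ∀ {k i} → InRange 4 k → Domain 4 k i → P k i
σ₄-domain-elim P p12 p13 p14 p21 p23 p24 p31 p32 p34 p41 p42 p43 = go
  where
  go : ∀ {k i} → InRange 4 k → Domain 4 k i → P k i
  go {1} {2} _ _ = p12
  go {1} {3} _ _ = p13
  go {1} {4} _ _ = p14
  go {2} {1} _ _ = p21
  go {2} {3} _ _ = p23
  go {2} {4} _ _ = p24
  go {3} {1} _ _ = p31
  go {3} {2} _ _ = p32
  go {3} {4} _ _ = p34
  go {4} {1} _ _ = p41
  go {4} {2} _ _ = p42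
  go {4} {3} _ _ = p43
  go {1} {1} _ (_ , 1≢1) = ⊥-elim (1≢1 refl)
  go {2} {2} _ (_ , 2≢2) = ⊥-elim (2≢2 refl)
  go {3} {3} _ (_ , 3≢3) = ⊥-elim (3≢3 refl)
  go {4} {4} _ (_ , 4≢4) = ⊥-elim (4≢4 refl)
  go {0} (() , _) _
  go {suc (suc (suc (suc (suc _))))} (_ , s≤s (s≤s (s≤s (s≤s ())))) _
  go {_} {0} _ ((() , _) , _)
  go {_} {suc (suc (suc (suc (suc _))))} _ ((_ , s≤s (s≤s (s≤s (s≤s ())))) , _)

σ₄-maps-into : MapsInto 4 σ₄
σ₄-maps-into = σ₄-domain-elim (λ k i → Domain 4 k (σ₄ k i))
  (d 1 2) (d 1 3) (d 1 4) (d 2 1) (d 2 3) (d 2 4) (d 3 1) (d 3 2) (d 3 4) (d 4 1) (d 4 2) (d 4 3)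
  where
  d : ∀ k i → {True (((1 ≤? σ₄ k i) ×-dec (σ₄ k i ≤? 4)) ×-dec ¬? (σ₄ k i ≟ k))} → Domain 4 k (σ₄ k i)
  d k i {t} = toWitness t

σ₄-cube : LeftInverse 4 (λ k → σ₄ k ∘ σ₄ k) σ₄
σ₄-cube = σ₄-domain-elim (λ k i → σ₄ k (σ₄ k (σ₄ k i)) ≡ i)
  refl refl refl refl refl refl refl refl refl refl refl refl

2^suc≡ : ∀ m → 2 ^ suc m ≡ 2 ^ m + 2 ^ m
2^suc≡ m = cong (2 ^ m +_) (+-identityʳ (2 ^ m))

σ-maps-into : ∀ n → MapsInto (2 ^ suc (suc n)) (σ (suc (suc n)))
σ-maps-into zero = σ₄-maps-into
σ-maps-into (suc n) = subst (λ N → MapsInto N (σ (3 + n))) (sym (2^suc≡ (2 + n)))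
  (Doubling.double-maps-into (σ (2 + n)) (σ-maps-into n))

σ-left-invertible : ∀ n → Σ (ℕ → ℕ → ℕ) λ g → LeftInverse (2 ^ suc (suc n)) g (σ (suc (suc n)))
σ-left-invertible zero = (λ k → σ₄ k ∘ σ₄ k) , σ₄-cube
σ-left-invertible (suc n) with σ-left-invertible n
... | g , inv = double H g ,
  subst (λ N → LeftInverse N (double H g) (σ (3 + n))) (sym (2^suc≡ (2 + n)))
    (double-left-inverse {H} {σ (2 + n)} {g} (σ-maps-into n) inv)
  where H = 2 ^ (2 + n)

σ-injective : ∀ n → Injective (2 ^ suc (suc n)) (σ (suc (suc n)))
σ-injective n with σ-left-invertible n
... | g , inv = left-inverse⇒injective {g = g} inv

lemma2 : (m : ℕ) → 3 ≤ m →
    (∀ h → h + h ≡ 2 ^ m →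
      ((∀ k i → 1 ≤ k → k ≤ h → 1 ≤ i → i ≤ 2 ^ m → i ≢ k → i ≢ k + h →
          σ m k i ≡ σ m (k + h) i)
      × (∀ i k → 1 ≤ i → i ≤ h → 1 ≤ k → k ≤ 2 ^ m → k ≢ i → k ≢ i + h →
          σ m k (i + h) + h ≡ σ m k i)
      × (∀ i j → 1 ≤ i → i ≤ 2 ^ m → 1 ≤ j → j ≤ 2 ^ m → i ≢ j →
          ((j ≡ i + h) ⇔ (σ m i j ≡ i + h))
          × ((j + h ≡ i) ⇔ (σ m i j + h ≡ i)))
      × (∀ k i j → 1 ≤ k → k ≤ 2 ^ m → 1 ≤ i → i ≤ 2 ^ m → 1 ≤ j → j ≤ 2 ^ m →
          i ≢ k → j ≢ k →
          ((j ≡ i + h) ⇔ (σ m k i ≡ σ m k j + h))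
          × ((j + h ≡ i) ⇔ (σ m k i + h ≡ σ m k j)))))
lemma2 (suc (suc zero)) (s≤s (s≤s ()))
lemma2 (suc (suc (suc n))) _ h h+h≡p
  -- 2 * h unfolds to h + (h + 0), and 2 ^ (3 + n) to 2 * 2 ^ (2 + n).
  with *-cancelˡ-≡ h (2 ^ (2 + n)) 2 (trans (cong (h +_) (+-identityʳ h)) h+h≡p)
... | refl =
  (λ k i 1≤k k≤h 1≤i i≤p → double[κ]≡double[κ+H] (1≤k , k≤h) (1≤i , bound i≤p)) ,
  (λ i k 1≤i i≤h 1≤k k≤p → double[x+H]+H≡double[x] (1≤i , i≤h) (1≤k , bound k≤p)) ,
  (λ i j 1≤i i≤p 1≤j j≤p i≢j → let i∈ = (1≤i , bound i≤p); j∈ = ((1≤j , bound j≤p) , i≢j ∘ sym) in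
     j≡i+H⇔double≡i+H maps inj i∈ j∈ , j+H≡i⇔double+H≡i maps inj i∈ j∈) ,
  (λ k i j 1≤k k≤p 1≤i i≤p 1≤j j≤p i≢k j≢k →
     let k∈ = (1≤k , bound k≤p); i∈ = ((1≤i , bound i≤p) , i≢k); j∈ = ((1≤j , bound j≤p) , j≢k) in
     j≡i+H⇔double[i]≡double[j]+H maps inj k∈ i∈ j∈ , j+H≡i⇔double[i]+H≡double[j] maps inj k∈ i∈ j∈)
  where
  H = 2 ^ (2 + n)
  open Doubling {H} (σ (2 + n))
  bound : ∀ {x} → x ≤ 2 ^ (3 + n) → x ≤ H + H
  bound {x} = subst (x ≤_) (sym h+h≡p)
  maps : MapsInto H (σ (2 + n))
  maps = σ-maps-into n
  inj : Injective (H + H) (σ (3 + n))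
  inj = subst (λ N → Injective N (σ (3 + n))) (sym h+h≡p) (σ-injective (suc n))
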